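{- For every $n\in\mathbb{N}$, the finite involutive poset $\mathcal{J}_K(\mathbf{F}_{\mathcal{K}}(n))$ dual to the free $n$-generated Kleene algebra is isomorphic (as a finite involutive poset) to $(\mathbf{D}^n)_k$.
   Context: A De Morgan algebra is a bounded distributive lattice with a unary operation $'$ satisfying $x''=x$ and $(x\wedge y)'=x'\vee y'$; a Kleene algebra is a De Morgan algebra satisfying $x\wedge x'\leq y\vee y'$; $\mathbf{F}_{\mathcal{K}}(n)$ is the free Kleene algebra on $n$ free generators. A finite involutive poset is a triple $(P,\leq,i)$ with $(P,\leq)$ a finite poset and $i\colon P\to P$ satisfying $x\leq y\Rightarrow i(y)\leq i(x)$ and $i(i(x))=x$; isomorphisms are order isomorphisms commuting with the involutions. For a finite Kleene algebra $\mathbf{A}=(A,\wedge,\vee,',0,1)$, $\mathcal{J}_K(\mathbf{A})=(P,\leq,i)$ where $P$ is the set of join-irreducible elements of $(A,\wedge,\vee,0,1)$ (nonzero $x$ with $x=a\vee b\Rightarrow x=a$ or $x=b$), $\leq$ is inherited, and $i(x)=\bigwedge\big(A\setminus\{a'\mid a\geq x\}\big)$. $\mathbf{D}=(\{0,1,2,3\},\leq,i)$ has order $2<0<3$, $2<1<3$, $0,1$ incomparable, and $i(0)=0$, $i(1)=1$, $i(2)=3$, $i(3)=2$; $\mathbf{D}^n$ is $\{0,1,2,3\}^n$ with coordinatewise order and involution. For a finite involutive poset $\mathbf{P}=(P,\leq,i)$, $\mathbf{P}_k$ denotes the subset $\{x\in P\mid x\leq i(x)\text{ or } i(x)\leq x\}$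 with inherited order and involution. -}

module Defs where

open import Data.Nat using (ℕ)
open import Data.Fin using (Fin)
open import Data.Vec using (Vec; []; _∷_)
open import Data.Bool using (Bool; true; false; T; _∧_; _∨_)
open import Data.Product using (Σ; _×_; proj₁; proj₂)
open import Data.Sum using (_⊎_)
open import Relation.Binary.PropositionalEquality using (_≡_)
open import Relation.Nullary using (¬_)
open import Function.Bundles using (_⇔_)

record KleeneAlgebra : Set₁ where
  infixr 7 _⊓_
  infixr 6 _⊔_
  infix 4 _≤_
  field
    Carrier : Set
    _⊓_ _⊔_ : Carrier → Carrier → Carrier
    _′ : Carrier → Carrier
    𝟘 𝟙 : Carrier
    ⊓-assoc : ∀ x y z → (x ⊓ y) ⊓ z ≡ x ⊓ (y ⊓ z)
    ⊔-assoc : ∀ x y z → (x ⊔ y) ⊔ z ≡ x ⊔ (y ⊔ z)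
    ⊓-comm  : ∀ x y → x ⊓ y ≡ y ⊓ x
    ⊔-comm  : ∀ x y → x ⊔ y ≡ y ⊔ x
    ⊓-absorbs-⊔ : ∀ x y → x ⊓ (x ⊔ y) ≡ x
    ⊔-absorbs-⊓ : ∀ x y → x ⊔ (x ⊓ y) ≡ x
    ⊓-distrib-⊔ : ∀ x y z → x ⊓ (y ⊔ z) ≡ (x ⊓ y) ⊔ (x ⊓ z)
    ⊓-identity : ∀ x → x ⊓ 𝟙 ≡ x
    ⊔-identity : ∀ x → x ⊔ 𝟘 ≡ x
    ′-involutive : ∀ x → (x ′) ′ ≡ x
    ′-deMorgan   : ∀ x y → (x ⊓ y) ′ ≡ (x ′) ⊔ (y ′)
    -- Kleene:  x ∧ x' ≤ y ∨ y'   (≤ is the lattice order a ≤ b iff a ∧ b = a)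
    kleene : ∀ x y → (x ⊓ (x ′)) ⊓ (y ⊔ (y ′)) ≡ x ⊓ (x ′)

  _≤_ : Carrier → Carrier → Set
  a ≤ b = a ⊓ b ≡ a

open KleeneAlgebra using (Carrier)

record IsHom (A B : KleeneAlgebra) (h : Carrier A → Carrier B) : Set where
  field
    pres-⊓ : ∀ x y → h (KleeneAlgebra._⊓_ A x y) ≡ KleeneAlgebra._⊓_ B (h x) (h y)
    pres-⊔ : ∀ x y → h (KleeneAlgebra._⊔_ A x y) ≡ KleeneAlgebra._⊔_ B (h x) (h y)
    pres-′ : ∀ x → h (KleeneAlgebra._′ A x) ≡ KleeneAlgebra._′ B (h x)
    pres-𝟘 : h (KleeneAlgebra.𝟘 A) ≡ KleeneAlgebra.𝟘 B
    pres-𝟙 : h (KleeneAlgebra.𝟙 A) ≡ KleeneAlgebra.𝟙 B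

IsFreeKleene : (n : ℕ) (F : KleeneAlgebra) → (Fin n → Carrier F) → Set₁
IsFreeKleene n F g =
  (A : KleeneAlgebra) (f : Fin n → Carrier A) →
  Σ (Carrier F → Carrier A) λ h →
    IsHom F A h × (∀ i → h (g i) ≡ f i) ×
    ((h' : Carrier F → Carrier A) → IsHom F A h' → (∀ i → h' (g i) ≡ f i) →
      ∀ x → h' x ≡ h x)

module _ (A : KleeneAlgebra) where
  open KleeneAlgebra A renaming (Carrier to ∣A∣)

  JoinIrreducible : ∣A∣ → Set
  JoinIrreducible x = ¬ (x ≡ 𝟘) × (∀ a b → x ≡ a ⊔ b → x ≡ a ⊎ x ≡ b)

  JK : Set
  JK = Σ ∣A∣ JoinIrreducible

  Excl : ∣A∣ → ∣A∣ → Set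
  Excl x c = ∀ a → x ≤ a → ¬ (c ≡ a ′)

  IsMeet : (∣A∣ → Set) → ∣A∣ → Set
  IsMeet S y = (∀ c → S c → y ≤ c) × (∀ z → (∀ c → S c → z ≤ c) → z ≤ y)

  -- i is the involution of J_K(A):  i(x) = ⋀ (A \ { a' | a ≥ x })
  IsJKInvolution : (JK → JK) → Set
  IsJKInvolution i = ∀ x → IsMeet (Excl (proj₁ x)) (proj₁ (i x))

data D : Set where
  d0 d1 d2 d3 : D

-- order: 2 < 0 < 3, 2 < 1 < 3
_≤ᴰ_ : D → D → Bool
d2 ≤ᴰ _  = true
_  ≤ᴰ d3 = true
d0 ≤ᴰ d0 = true
d1 ≤ᴰ d1 = true
_  ≤ᴰ _  = false

invᴰ : D → D
invᴰ d0 = d0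
invᴰ d1 = d1
invᴰ d2 = d3
invᴰ d3 = d2

_≤ⁿ_ : {n : ℕ} → Vec D n → Vec D n → Bool
[] ≤ⁿ [] = true
(x ∷ xs) ≤ⁿ (y ∷ ys) = (x ≤ᴰ y) ∧ (xs ≤ⁿ ys)

invⁿ : {n : ℕ} → Vec D n → Vec D n
invⁿ [] = []
invⁿ (x ∷ xs) = invᴰ x ∷ invⁿ xs

Dk : ℕ → Set
Dk n = Σ (Vec D n) λ x → T ((x ≤ⁿ invⁿ x) ∨ (invⁿ x ≤ⁿ x))

-- Isomorphism of involutive posets J_K(A) (with involution i) ≅ (D^n)_k,
-- elements of subsets compared by their underlying elements.

record JKIso (A : KleeneAlgebra) (i : JK A → JK A) (n : ℕ) : Set where
  field
    to   : JK A → Dk n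
    from : Dk n → JK A
    from∘to : ∀ x → proj₁ (from (to x)) ≡ proj₁ x
    to∘from : ∀ y → proj₁ (to (from y)) ≡ proj₁ y
    order   : ∀ x y → (KleeneAlgebra._≤_ A (proj₁ x) (proj₁ y)) ⇔ T (proj₁ (to x) ≤ⁿ proj₁ (to y))
    involution : ∀ x → proj₁ (to (i x)) ≡ invⁿ (proj₁ (to x))

module Submission where

-- Write x_v = ⋀ᵢ ℓ(gᵢ, vᵢ) for v ∈ Dⁿ, where the literal ℓ(a, c) is a, a′, a ∧ a′, 1
-- for c = 0, 1, 2, 3.  Let B be the Kleene algebra of down-sets of (Dⁿ)_k, with
-- S′ = { v ∈ (Dⁿ)_k | i(v) ∉ S }.  The map k(S) = ⋁_{v ∈ S} x_v is a Kleene
-- homomorphism B → F sending the down-set Genᵢ = { v | vᵢ ≤ 0 } to gᵢ; the Kleene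
-- inequality enters through the decomposition x_u ≤ ⋁ { x_w | w ∈ (Dⁿ)_k, w ≤ u }.
-- Freeness gives a homomorphism Φ : F → B with Φ(gᵢ) = Genᵢ, and k ∘ Φ = id by
-- uniqueness.  Hence a = ⋁_{v ∈ Φ(a)} x_v, and for v ∈ (Dⁿ)_k we get x_v ≤ a iff
-- v ∈ Φ(a).  From this: the x_v (v ∈ (Dⁿ)_k) are exactly the join-irreducibles,
-- v ↦ x_v is an order embedding, and the J_K-involution of x_v is x_{i(v)}.

open import Defs
open import Data.Nat using (ℕ; zero; suc)
open import Data.Fin using (Fin; zero; suc)
open import Data.Vec using (Vec; []; _∷_; lookup; replicate; _[_]≔_)
open import Data.Vec.Properties using (lookup∘update)
open import Data.Bool using (Bool; true; false; T; _∧_; _∨_; not; if_then_else_)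
open import Data.Bool.Properties
  using ( ∧-assoc; ∨-assoc; ∧-comm; ∨-comm; ∧-distribˡ-∨; ∧-abs-∨; ∨-abs-∧
        ; ∨-identityʳ; not-involutive; T-irrelevant)
open import Data.Unit using (tt)
open import Data.Empty using (⊥-elim)
open import Data.Product using (Σ; _×_; _,_; proj₁; proj₂; map)
open import Data.Sum using (_⊎_; inj₁; inj₂; [_,_])
open import Function using (_∘_)
open import Function.Bundles using (_⇔_; mk⇔)
open import Relation.Binary.PropositionalEquality
  using (_≡_; refl; sym; trans; cong; cong₂; subst; subst₂; module ≡-Reasoning)
open import Relation.Nullary using (¬_; yes; no)
open import Relation.Nullary.Decidable using (T?)

∧-intro : ∀ {a b} → T a → T b → T (a ∧ b)
∧-intro {true} _ q = q

∧-fst : ∀ {a b} → T (a ∧ b) → T a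
∧-fst {true} _ = tt

∧-snd : ∀ {a b} → T (a ∧ b) → T b
∧-snd {true} q = q

∨-inl : ∀ {a b} → T a → T (a ∨ b)
∨-inl {true} _ = tt

∨-inr : ∀ {a b} → T b → T (a ∨ b)
∨-inr {true} _ = tt
∨-inr {false} q = q

∨-elim : ∀ {a b} → T (a ∨ b) → T a ⊎ T b
∨-elim {true} _ = inj₁ tt
∨-elim {false} q = inj₂ q

not-elim : ∀ {a} → T (not a) → ¬ T a
not-elim {false} _ ()

not-intro : ∀ {a} → ¬ T a → T (not a)
not-intro {true} h = h tt
not-intro {false} _ = tt

_⇒_ : Bool → Bool → Bool
a ⇒ b = not a ∨ b
infixr 1 _⇒_

⇒-intro : ∀ {a b} → (T a → T b) → T (a ⇒ b)
⇒-intro {true} h = h tt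
⇒-intro {false} _ = tt

⇒-elim : ∀ {a b} → T (a ⇒ b) → T a → T b
⇒-elim {true} h _ = h

∧-absorb : ∀ a b → (T a → T b) → a ∧ b ≡ a
∧-absorb true true _ = refl
∧-absorb true false h = ⊥-elim (h tt)
∧-absorb false _ _ = refl

-- The involutive poset D

-- D is finite, so a Boolean property of one, two or three of its elements is
-- established by evaluating it on every instance.
allᴰ : (D → Bool) → Bool
allᴰ p = p d0 ∧ p d1 ∧ p d2 ∧ p d3

allᴰ-sound : (p : D → Bool) → T (allᴰ p) → ∀ a → T (p a)
allᴰ-sound p h d0 = ∧-fst h
allᴰ-sound p h d1 = ∧-fst (∧-snd {p d0} h)
allᴰ-sound p h d2 = ∧-fst (∧-snd {p d1} (∧-snd {p d0} h))
allᴰ-sound p h d3 = ∧-snd {p d2} (∧-snd {p d1} (∧-snd {p d0} h))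

decide₂ : (p : D → D → Bool) → T (allᴰ λ a → allᴰ λ b → p a b) → ∀ a b → T (p a b)
decide₂ p h a = allᴰ-sound (p a) (allᴰ-sound (λ a → allᴰ (p a)) h a)

decide₃ : (p : D → D → D → Bool) → T (allᴰ λ a → allᴰ λ b → allᴰ λ c → p a b c) →
  ∀ a b c → T (p a b c)
decide₃ p h a = decide₂ (p a) (allᴰ-sound (λ a → allᴰ λ b → allᴰ (p a b)) h a)

≤ᴰ-refl : ∀ a → T (a ≤ᴰ a)
≤ᴰ-refl = allᴰ-sound (λ a → a ≤ᴰ a) tt

≤ᴰ-trans : ∀ a b c → T (a ≤ᴰ b) → T (b ≤ᴰ c) → T (a ≤ᴰ c)
≤ᴰ-trans a b c p q =
  ⇒-elim (⇒-elim (decide₃ (λ a b c → a ≤ᴰ b ⇒ b ≤ᴰ c ⇒ a ≤ᴰ c) tt a b c) p) q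

≤ᴰ-antisym : ∀ a b → T (a ≤ᴰ b) → T (b ≤ᴰ a) → a ≡ b
≤ᴰ-antisym d0 d0 _ _ = refl
≤ᴰ-antisym d1 d1 _ _ = refl
≤ᴰ-antisym d2 d2 _ _ = refl
≤ᴰ-antisym d3 d3 _ _ = refl

invᴰ-involutive : ∀ a → invᴰ (invᴰ a) ≡ a
invᴰ-involutive d0 = refl
invᴰ-involutive d1 = refl
invᴰ-involutive d2 = refl
invᴰ-involutive d3 = refl

invᴰ-antitone : ∀ a b → T (a ≤ᴰ b) → T (invᴰ b ≤ᴰ invᴰ a)
invᴰ-antitone a b = ⇒-elim (decide₂ (λ a b → a ≤ᴰ b ⇒ invᴰ b ≤ᴰ invᴰ a) tt a b)

meetᴰ : D → D → D
meetᴰ d3 b  = b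
meetᴰ d0 d3 = d0
meetᴰ d1 d3 = d1
meetᴰ d2 d3 = d2
meetᴰ d0 d0 = d0
meetᴰ d1 d1 = d1
meetᴰ _  _  = d2

meetᴰ-lb₁ : ∀ a b → T (meetᴰ a b ≤ᴰ a)
meetᴰ-lb₁ = decide₂ (λ a b → meetᴰ a b ≤ᴰ a) tt

meetᴰ-lb₂ : ∀ a b → T (meetᴰ a b ≤ᴰ b)
meetᴰ-lb₂ = decide₂ (λ a b → meetᴰ a b ≤ᴰ b) tt

≤ⁿ-refl : ∀ {n} (v : Vec D n) → T (v ≤ⁿ v)
≤ⁿ-refl [] = tt
≤ⁿ-refl (a ∷ v) = ∧-intro (≤ᴰ-refl a) (≤ⁿ-refl v)

≤ⁿ-trans : ∀ {n} (u v w : Vec D n) → T (u ≤ⁿ v) → T (v ≤ⁿ w) → T (u ≤ⁿ w)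
≤ⁿ-trans [] [] [] _ _ = tt
≤ⁿ-trans (a ∷ u) (b ∷ v) (c ∷ w) p q =
  ∧-intro (≤ᴰ-trans a b c (∧-fst p) (∧-fst q))
          (≤ⁿ-trans u v w (∧-snd {a ≤ᴰ b} p) (∧-snd {b ≤ᴰ c} q))

≤ⁿ-antisym : ∀ {n} (u v : Vec D n) → T (u ≤ⁿ v) → T (v ≤ⁿ u) → u ≡ v
≤ⁿ-antisym [] [] _ _ = refl
≤ⁿ-antisym (a ∷ u) (b ∷ v) p q =
  cong₂ _∷_ (≤ᴰ-antisym a b (∧-fst p) (∧-fst q))
            (≤ⁿ-antisym u v (∧-snd {a ≤ᴰ b} p) (∧-snd {b ≤ᴰ a} q))

invⁿ-involutive : ∀ {n} (v : Vec D n) → invⁿ (invⁿ v) ≡ v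
invⁿ-involutive [] = refl
invⁿ-involutive (a ∷ v) = cong₂ _∷_ (invᴰ-involutive a) (invⁿ-involutive v)

invⁿ-antitone : ∀ {n} (u v : Vec D n) → T (u ≤ⁿ v) → T (invⁿ v ≤ⁿ invⁿ u)
invⁿ-antitone [] [] _ = tt
invⁿ-antitone (a ∷ u) (b ∷ v) p =
  ∧-intro (invᴰ-antitone a b (∧-fst p)) (invⁿ-antitone u v (∧-snd {a ≤ᴰ b} p))

≤ⁿ-lookup : ∀ {n} (u v : Vec D n) i → T (u ≤ⁿ v) → T (lookup u i ≤ᴰ lookup v i)
≤ⁿ-lookup (a ∷ u) (b ∷ v) zero p = ∧-fst p
≤ⁿ-lookup (a ∷ u) (b ∷ v) (suc i) p = ≤ⁿ-lookup u v i (∧-snd {a ≤ᴰ b} p)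

lookup-≤ⁿ : ∀ {n} (u v : Vec D n) → (∀ i → T (lookup u i ≤ᴰ lookup v i)) → T (u ≤ⁿ v)
lookup-≤ⁿ [] [] _ = tt
lookup-≤ⁿ (a ∷ u) (b ∷ v) p = ∧-intro (p zero) (lookup-≤ⁿ u v (p ∘ suc))

lookup-invⁿ : ∀ {n} (v : Vec D n) i → lookup (invⁿ v) i ≡ invᴰ (lookup v i)
lookup-invⁿ (a ∷ v) zero = refl
lookup-invⁿ (a ∷ v) (suc i) = lookup-invⁿ v i

meetⁿ : ∀ {n} → Vec D n → Vec D n → Vec D n
meetⁿ [] [] = []
meetⁿ (a ∷ v) (b ∷ w) = meetᴰ a b ∷ meetⁿ v w

meetⁿ-lb₁ : ∀ {n} (v w : Vec D n) → T (meetⁿ v w ≤ⁿ v)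
meetⁿ-lb₁ [] [] = tt
meetⁿ-lb₁ (a ∷ v) (b ∷ w) = ∧-intro (meetᴰ-lb₁ a b) (meetⁿ-lb₁ v w)

meetⁿ-lb₂ : ∀ {n} (v w : Vec D n) → T (meetⁿ v w ≤ⁿ w)
meetⁿ-lb₂ [] [] = tt
meetⁿ-lb₂ (a ∷ v) (b ∷ w) = ∧-intro (meetᴰ-lb₂ a b) (meetⁿ-lb₂ v w)

isDk : ∀ {n} → Vec D n → Bool
isDk v = (v ≤ⁿ invⁿ v) ∨ (invⁿ v ≤ⁿ v)

isDk-invⁿ : ∀ {n} (v : Vec D n) → isDk (invⁿ v) ≡ isDk v
isDk-invⁿ v rewrite invⁿ-involutive v = ∨-comm (invⁿ v ≤ⁿ v) (v ≤ⁿ invⁿ v)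

Dk-invⁿ : ∀ {n} (v : Vec D n) → T (isDk v) → T (isDk (invⁿ v))
Dk-invⁿ v = subst T (sym (isDk-invⁿ v))

top : ∀ n → Vec D n
top n = replicate n d3

basis : ∀ {n} → Fin n → D → Vec D n
basis {n} i c = top n [ i ]≔ c

no-d3 : ∀ {n} → Vec D n → Bool
no-d3 [] = true
no-d3 (d3 ∷ v) = false
no-d3 (_  ∷ v) = no-d3 v

no-d3-Dk : ∀ {n} (v : Vec D n) → T (no-d3 v) → T (isDk v)
no-d3-Dk v p = ∨-inl (below v p)
  where
    below : ∀ {n} (v : Vec D n) → T (no-d3 v) → T (v ≤ⁿ invⁿ v)
    below [] _ = tt
    below (d0 ∷ v) p = below v p
    below (d1 ∷ v) p = below v p
    below (d2 ∷ v) p = below v p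

has-d2 : ∀ {n} → Vec D n → Bool
has-d2 [] = false
has-d2 (d2 ∷ v) = true
has-d2 (_  ∷ v) = has-d2 v

no-d2-Dk : ∀ {n} (v : Vec D n) → has-d2 v ≡ false → T (isDk v)
no-d2-Dk v p = ∨-inr {v ≤ⁿ invⁿ v} (above v p)
  where
    above : ∀ {n} (v : Vec D n) → has-d2 v ≡ false → T (invⁿ v ≤ⁿ v)
    above [] _ = tt
    above (d0 ∷ v) p = above v p
    above (d1 ∷ v) p = above v p
    above (d3 ∷ v) p = above v p

top-Dk : ∀ n → T (isDk (top n))
top-Dk n = no-d2-Dk (top n) (no-d2 n)
  where
    no-d2 : ∀ n → has-d2 (top n) ≡ false
    no-d2 zero = refl
    no-d2 (suc n) = no-d2 n

-- Finite folds over Dᵐ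

fold : ∀ {X : Set} {m} → (X → X → X) → (Vec D m → X) → X
fold {m = zero} _∙_ h = h []
fold {m = suc m} _∙_ h = (part d0 ∙ part d1) ∙ (part d2 ∙ part d3)
  where part = λ c → fold _∙_ (λ v → h (c ∷ v))

module _ {X : Set} (_∙_ : X → X → X) where

  fold-lub : (R : X → X → Set) → (∀ {a b c} → R a c → R b c → R (a ∙ b) c) →
    ∀ {m} (h : Vec D m → X) c → (∀ v → R (h v) c) → R (fold _∙_ h) c
  fold-lub R close {zero} h c p = p []
  fold-lub R close {suc m} h c p =
    close (close (part d0) (part d1)) (close (part d2) (part d3))
    where part = λ d → fold-lub R close (λ v → h (d ∷ v)) c (λ v → p (d ∷ v))

  fold-ub : (R : X → X → Set) → (∀ {a} → R a a) → (∀ {a b c} → R a b → R b c → R a c) →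
    (∀ {a b} → R a (a ∙ b)) → (∀ {a b} → R b (a ∙ b)) →
    ∀ {m} (h : Vec D m → X) v → R (h v) (fold _∙_ h)
  fold-ub R reflexive transitive ub₁ ub₂ h [] = reflexive
  fold-ub R reflexive transitive ub₁ ub₂ h (c ∷ v) =
    transitive (fold-ub R reflexive transitive ub₁ ub₂ (λ v → h (c ∷ v)) v) (into c)
    where
      into : ∀ c → R (fold _∙_ (λ v → h (c ∷ v))) (fold _∙_ h)
      into d0 = transitive ub₁ ub₁
      into d1 = transitive ub₂ ub₁
      into d2 = transitive ub₁ ub₂
      into d3 = transitive ub₂ ub₂

  fold-hom : {Y : Set} (_∘′_ : Y → Y → Y) (φ : X → Y) → (∀ a b → φ (a ∙ b) ≡ φ a ∘′ φ b) →
    ∀ {m} (h : Vec D m → X) → φ (fold _∙_ h) ≡ fold _∘′_ (φ ∘ h)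
  fold-hom _∘′_ φ hom {zero} h = refl
  fold-hom _∘′_ φ hom {suc m} h =
    trans (hom _ _) (cong₂ _∘′_ (trans (hom _ _) (cong₂ _∘′_ (part d0) (part d1)))
                                (trans (hom _ _) (cong₂ _∘′_ (part d2) (part d3))))
    where part = λ c → fold-hom _∘′_ φ hom (λ v → h (c ∷ v))

  fold-irreducible : ∀ {y} → (∀ a b → y ≡ a ∙ b → y ≡ a ⊎ y ≡ b) →
    ∀ {m} (h : Vec D m → X) → y ≡ fold _∙_ h → Σ (Vec D m) λ v → y ≡ h v
  fold-irreducible irr {zero} h e = [] , e
  fold-irreducible {y} irr {suc m} h e =
    [ [ part d0 , part d1 ] ∘ irr _ _ , [ part d2 , part d3 ] ∘ irr _ _ ] (irr _ _ e)
    where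
      part : ∀ c → y ≡ fold _∙_ (λ v → h (c ∷ v)) → Σ (Vec D (suc m)) λ v → y ≡ h v
      part c e′ = map (c ∷_) (λ e″ → e″) (fold-irreducible irr (λ v → h (c ∷ v)) e′)

-- Order-theoretic facts in an arbitrary Kleene algebra

module KleeneOrder (A : KleeneAlgebra) where
  open KleeneAlgebra A

  ⊓-idem : ∀ x → x ⊓ x ≡ x
  ⊓-idem x = trans (cong (x ⊓_) (sym (⊔-absorbs-⊓ x x))) (⊓-absorbs-⊔ x (x ⊓ x))

  ≤-refl : ∀ {x} → x ≤ x
  ≤-refl {x} = ⊓-idem x

  ≡⇒≤ : ∀ {x y} → x ≡ y → x ≤ y
  ≡⇒≤ refl = ≤-refl

  ≤-trans : ∀ {a b c} → a ≤ b → b ≤ c → a ≤ c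
  ≤-trans {a} {b} {c} p q = begin
    a ⊓ c         ≡⟨ cong (_⊓ c) p ⟨
    (a ⊓ b) ⊓ c   ≡⟨ ⊓-assoc a b c ⟩
    a ⊓ (b ⊓ c)   ≡⟨ cong (a ⊓_) q ⟩
    a ⊓ b         ≡⟨ p ⟩
    a             ∎
    where open ≡-Reasoning

  ≤-antisym : ∀ {a b} → a ≤ b → b ≤ a → a ≡ b
  ≤-antisym {a} {b} p q = trans (sym p) (trans (⊓-comm a b) q)

  module ≤-Reasoning where
    open import Relation.Binary.Reasoning.Base.Single _≤_ ≤-refl ≤-trans public
      using (begin_; _∎; step-≡-⟩; step-≡-⟨; step-≡-∣)
    open import Relation.Binary.Reasoning.Base.Single _≤_ ≤-refl ≤-trans
      using (_IsRelatedTo_; ∼-go)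
    open import Relation.Binary.Reasoning.Syntax using (module ≤-syntax)
    open ≤-syntax _IsRelatedTo_ _IsRelatedTo_ ∼-go public

  ⊔⇒≤ : ∀ {a b} → a ⊔ b ≡ b → a ≤ b
  ⊔⇒≤ {a} {b} p = trans (cong (a ⊓_) (sym p)) (⊓-absorbs-⊔ a b)

  ≤⇒⊔ : ∀ {a b} → a ≤ b → a ⊔ b ≡ b
  ≤⇒⊔ {a} {b} p = begin
    a ⊔ b         ≡⟨ cong (_⊔ b) p ⟨
    (a ⊓ b) ⊔ b   ≡⟨ ⊔-comm (a ⊓ b) b ⟩
    b ⊔ (a ⊓ b)   ≡⟨ cong (b ⊔_) (⊓-comm a b) ⟩
    b ⊔ (b ⊓ a)   ≡⟨ ⊔-absorbs-⊓ b a ⟩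
    b             ∎
    where open ≡-Reasoning

  ⊔-ub₁ : ∀ {a b} → a ≤ a ⊔ b
  ⊔-ub₁ {a} {b} = ⊓-absorbs-⊔ a b

  ⊔-ub₂ : ∀ {a b} → b ≤ a ⊔ b
  ⊔-ub₂ {a} {b} = trans (cong (b ⊓_) (⊔-comm a b)) (⊓-absorbs-⊔ b a)

  ⊔-lub : ∀ {a b c} → a ≤ c → b ≤ c → a ⊔ b ≤ c
  ⊔-lub {a} {b} {c} p q =
    ⊔⇒≤ (trans (⊔-assoc a b c) (trans (cong (a ⊔_) (≤⇒⊔ q)) (≤⇒⊔ p)))

  ⊓-lb₁ : ∀ {a b} → a ⊓ b ≤ a
  ⊓-lb₁ {a} {b} = ⊔⇒≤ (trans (⊔-comm (a ⊓ b) a) (⊔-absorbs-⊓ a b))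

  ⊓-lb₂ : ∀ {a b} → a ⊓ b ≤ b
  ⊓-lb₂ {a} {b} = trans (⊓-assoc a b b) (cong (a ⊓_) (⊓-idem b))

  ⊓-glb : ∀ {a b c} → c ≤ a → c ≤ b → c ≤ a ⊓ b
  ⊓-glb {a} {b} {c} p q = trans (sym (⊓-assoc c a b)) (trans (cong (_⊓ b) p) q)

  ⊓-mono : ∀ {a b c d} → a ≤ b → c ≤ d → a ⊓ c ≤ b ⊓ d
  ⊓-mono p q = ⊓-glb (≤-trans ⊓-lb₁ p) (≤-trans ⊓-lb₂ q)

  ⊓-comm-≤ : ∀ {a b} → a ⊓ b ≤ b ⊓ a
  ⊓-comm-≤ = ⊓-glb ⊓-lb₂ ⊓-lb₁

  0≤ : ∀ {a} → 𝟘 ≤ a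
  0≤ {a} = ⊔⇒≤ (trans (⊔-comm 𝟘 a) (⊔-identity a))

  ≤1 : ∀ {a} → a ≤ 𝟙
  ≤1 {a} = ⊓-identity a

  ⊓-⊔-lub : ∀ {a b c d} → a ⊓ b ≤ d → a ⊓ c ≤ d → a ⊓ (b ⊔ c) ≤ d
  ⊓-⊔-lub {a} {b} {c} p q = ≤-trans (≡⇒≤ (⊓-distrib-⊔ a b c)) (⊔-lub p q)

  ⊔-⊓-lub : ∀ {a b c d} → b ⊓ a ≤ d → c ⊓ a ≤ d → (b ⊔ c) ⊓ a ≤ d
  ⊔-⊓-lub p q = ≤-trans ⊓-comm-≤ (⊓-⊔-lub (≤-trans ⊓-comm-≤ p) (≤-trans ⊓-comm-≤ q))

  ′-antitone : ∀ {a b} → a ≤ b → b ′ ≤ a ′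
  ′-antitone {a} {b} p =
    ⊔⇒≤ (trans (⊔-comm (b ′) (a ′)) (trans (sym (′-deMorgan a b)) (cong _′ p)))

  ′-swap : ∀ {a b} → a ≤ b ′ → b ≤ a ′
  ′-swap {a} {b} p = subst (_≤ a ′) (′-involutive b) (′-antitone p)

  ≤′′ : ∀ {a} → a ≤ (a ′) ′
  ≤′′ {a} = ≡⇒≤ (sym (′-involutive a))

  𝟙′ : 𝟙 ′ ≡ 𝟘
  𝟙′ = ≤-antisym (subst (𝟙 ′ ≤_) (′-involutive 𝟘) (′-antitone ≤1)) 0≤

  ⋁ ⋀ : ∀ {m} → (Vec D m → Carrier) → Carrier
  ⋁ = fold _⊔_
  ⋀ = fold _⊓_

  ⋁-ub : ∀ {m} (h : Vec D m → Carrier) v → h v ≤ ⋁ h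
  ⋁-ub = fold-ub _⊔_ _≤_ ≤-refl ≤-trans ⊔-ub₁ ⊔-ub₂

  ⋁-lub : ∀ {m} (h : Vec D m → Carrier) c → (∀ v → h v ≤ c) → ⋁ h ≤ c
  ⋁-lub = fold-lub _⊔_ _≤_ ⊔-lub

  ⋀-glb : ∀ {m} (h : Vec D m → Carrier) c → (∀ v → c ≤ h v) → c ≤ ⋀ h
  ⋀-glb = fold-lub _⊓_ (λ x c → c ≤ x) ⊓-glb

  ⋁[_]_ : ∀ {m} → (Vec D m → Bool) → (Vec D m → Carrier) → Carrier
  ⋁[ p ] h = ⋁ λ v → if p v then h v else 𝟘

  ⋁[]-ub : ∀ {m} (p : Vec D m → Bool) h v → T (p v) → h v ≤ ⋁[ p ] h
  ⋁[]-ub p h v pv = ≤-trans (selected (p v) pv) (⋁-ub _ v)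
    where
      selected : ∀ b → T b → h v ≤ (if b then h v else 𝟘)
      selected true _ = ≤-refl

  ⋁[]-lub : ∀ {m} (p : Vec D m → Bool) h c → (∀ v → T (p v) → h v ≤ c) → ⋁[ p ] h ≤ c
  ⋁[]-lub p h c bound = ⋁-lub _ c λ v → selected (p v) (bound v)
    where
      selected : ∀ {v} b → (T b → h v ≤ c) → (if b then h v else 𝟘) ≤ c
      selected true q = q tt
      selected false _ = 0≤

  ⋁[]-⊓-lub : ∀ {m} (p : Vec D m → Bool) h a c → (∀ v → T (p v) → a ⊓ h v ≤ c) →
    a ⊓ ⋁[ p ] h ≤ c
  ⋁[]-⊓-lub p h a c bound = fold-lub _⊔_ (λ x c → a ⊓ x ≤ c) ⊓-⊔-lub _ c λ v → selected (p v) (bound v)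
    where
      selected : ∀ {v} b → (T b → a ⊓ h v ≤ c) → a ⊓ (if b then h v else 𝟘) ≤ c
      selected true q = q tt
      selected false _ = ≤-trans ⊓-lb₂ 0≤

-- Literals and monomials in an arbitrary Kleene algebra

module Monomials (A : KleeneAlgebra) where
  open KleeneAlgebra A
  open KleeneOrder A

  lit : Carrier → D → Carrier
  lit a d0 = a
  lit a d1 = a ′
  lit a d2 = a ⊓ a ′
  lit a d3 = 𝟙

  lit-mono : ∀ a c d → T (c ≤ᴰ d) → lit a c ≤ lit a d
  lit-mono a c  d3 _ = ≤1
  lit-mono a d0 d0 _ = ≤-refl
  lit-mono a d1 d1 _ = ≤-refl
  lit-mono a d2 d2 _ = ≤-refl
  lit-mono a d2 d0 _ = ⊓-lb₁
  lit-mono a d2 d1 _ = ⊓-lb₂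

  lit-meet : ∀ a c d → lit a c ⊓ lit a d ≤ lit a (meetᴰ c d)
  lit-meet a d3 d  = ⊓-lb₂
  lit-meet a d0 d3 = ⊓-lb₁
  lit-meet a d1 d3 = ⊓-lb₁
  lit-meet a d2 d3 = ⊓-lb₁
  lit-meet a d0 d0 = ⊓-lb₁
  lit-meet a d0 d1 = ≤-refl
  lit-meet a d0 d2 = ⊓-lb₂
  lit-meet a d1 d0 = ⊓-comm-≤
  lit-meet a d1 d1 = ⊓-lb₁
  lit-meet a d1 d2 = ⊓-lb₂
  lit-meet a d2 d0 = ⊓-lb₁
  lit-meet a d2 d1 = ⊓-lb₁
  lit-meet a d2 d2 = ⊓-lb₁

  lit-disjoint : ∀ a c d → ¬ T (invᴰ d ≤ᴰ c) → lit a c ≤ lit a d ′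
  lit-disjoint a c  d3 h = ⊥-elim (h tt)
  lit-disjoint a d0 d0 h = ⊥-elim (h tt)
  lit-disjoint a d3 d0 h = ⊥-elim (h tt)
  lit-disjoint a d1 d1 h = ⊥-elim (h tt)
  lit-disjoint a d3 d1 h = ⊥-elim (h tt)
  lit-disjoint a d3 d2 h = ⊥-elim (h tt)
  lit-disjoint a d1 d0 _ = ≤-refl
  lit-disjoint a d2 d0 _ = ⊓-lb₂
  lit-disjoint a d0 d1 _ = ≤′′
  lit-disjoint a d2 d1 _ = ≤-trans ⊓-lb₁ ≤′′
  lit-disjoint a d0 d2 _ = ≤-trans (≤-trans ≤′′ ⊔-ub₂) (≡⇒≤ (sym (′-deMorgan a (a ′))))
  lit-disjoint a d1 d2 _ = ≤-trans ⊔-ub₁ (≡⇒≤ (sym (′-deMorgan a (a ′))))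
  lit-disjoint a d2 d2 _ = ≤-trans (≤-trans ⊓-lb₂ ⊔-ub₁) (≡⇒≤ (sym (′-deMorgan a (a ′))))

  mono : ∀ {m} → (Fin m → Carrier) → Vec D m → Carrier
  mono f [] = 𝟙
  mono f (c ∷ v) = lit (f zero) c ⊓ mono (f ∘ suc) v

  mono-mono : ∀ {m} f (v w : Vec D m) → T (v ≤ⁿ w) → mono f v ≤ mono f w
  mono-mono f [] [] _ = ≤-refl
  mono-mono f (c ∷ v) (d ∷ w) p =
    ⊓-mono (lit-mono (f zero) c d (∧-fst p)) (mono-mono (f ∘ suc) v w (∧-snd {c ≤ᴰ d} p))

  mono-meet : ∀ {m} f (v w : Vec D m) → mono f v ⊓ mono f w ≤ mono f (meetⁿ v w)
  mono-meet f [] [] = ⊓-lb₁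
  mono-meet f (c ∷ v) (d ∷ w) =
    ⊓-glb (≤-trans (⊓-mono ⊓-lb₁ ⊓-lb₁) (lit-meet (f zero) c d))
          (≤-trans (⊓-mono ⊓-lb₂ ⊓-lb₂) (mono-meet (f ∘ suc) v w))

  mono-lit : ∀ {m} f (w : Vec D m) i → mono f w ≤ lit (f i) (lookup w i)
  mono-lit f (c ∷ w) zero = ⊓-lb₁
  mono-lit f (c ∷ w) (suc i) = ≤-trans ⊓-lb₂ (mono-lit (f ∘ suc) w i)

  mono-top : ∀ {m} f → mono f (top m) ≡ 𝟙
  mono-top {zero} f = refl
  mono-top {suc m} f = trans (cong (𝟙 ⊓_) (mono-top (f ∘ suc))) (⊓-idem 𝟙)

  mono-basis : ∀ {m} f (i : Fin m) c → mono f (basis i c) ≡ lit (f i) c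
  mono-basis {suc m} f zero c = trans (cong (lit (f zero) c ⊓_) (mono-top (f ∘ suc))) (⊓-identity _)
  mono-basis {suc m} f (suc i) c =
    trans (⊓-comm 𝟙 _) (trans (⊓-identity _) (mono-basis (f ∘ suc) i c))

  mono-kleene : ∀ {m} f (u : Vec D m) → has-d2 u ≡ true → ∀ b → mono f u ≤ b ⊔ b ′
  mono-kleene f (d2 ∷ u) _ b = ≤-trans ⊓-lb₁ (kleene (f zero) b)
  mono-kleene f (d0 ∷ u) p b = ≤-trans ⊓-lb₂ (mono-kleene (f ∘ suc) u p b)
  mono-kleene f (d1 ∷ u) p b = ≤-trans ⊓-lb₂ (mono-kleene (f ∘ suc) u p b)
  mono-kleene f (d3 ∷ u) p b = ≤-trans ⊓-lb₂ (mono-kleene (f ∘ suc) u p b)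

  -- Below an element a with a ≤ b ⊔ b′ for all b, a monomial x_u is covered by
  -- the monomials x_w, w ≤ u without coordinate 3 (each 3 is split into 0 and 1).
  split-d3 : ∀ {a} → (∀ b → a ≤ b ⊔ b ′) → ∀ {m} (f : Fin m → Carrier) u →
    a ⊓ mono f u ≤ ⋁[ (λ w → no-d3 w ∧ (w ≤ⁿ u)) ] mono f
  split-d3 small f [] = ⊓-lb₂
  split-d3 {a} small f (c ∷ u) = begin
    a ⊓ (lit f₀ c ⊓ mono f′ u)    ≤⟨ ⊓-glb (≤-trans (⊓-mono ≤-refl ⊓-lb₁) (cover-≥ c))
                                            (⊓-mono ≤-refl ⊓-lb₂) ⟩
    cover c ⊓ (a ⊓ mono f′ u)     ≤⟨ ⊓-mono ≤-refl (split-d3 small f′ u) ⟩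
    cover c ⊓ ⋁[ P′ ] mono f′     ≤⟨ ⋁[]-⊓-lub P′ (mono f′) _ _ (extend c) ⟩
    ⋁[ P c ] mono f               ∎
    where
      open ≤-Reasoning
      f₀ = f zero
      f′ = f ∘ suc
      P′ = λ w → no-d3 w ∧ (w ≤ⁿ u)
      P  = λ c w → no-d3 w ∧ (w ≤ⁿ (c ∷ u))
      cover : D → Carrier
      cover d3 = f₀ ⊔ f₀ ′
      cover c  = lit f₀ c
      cover-≥ : ∀ c → a ⊓ lit f₀ c ≤ cover c
      cover-≥ d0 = ⊓-lb₂
      cover-≥ d1 = ⊓-lb₂
      cover-≥ d2 = ⊓-lb₂
      cover-≥ d3 = ≤-trans ⊓-lb₁ (small f₀)
      extend : ∀ c w → T (P′ w) → cover c ⊓ mono f′ w ≤ ⋁[ P c ] mono f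
      extend d0 w p = ⋁[]-ub (P d0) (mono f) (d0 ∷ w) p
      extend d1 w p = ⋁[]-ub (P d1) (mono f) (d1 ∷ w) p
      extend d2 w p = ⋁[]-ub (P d2) (mono f) (d2 ∷ w) p
      extend d3 w p = ⊔-⊓-lub (⋁[]-ub (P d3) (mono f) (d0 ∷ w) p)
                              (⋁[]-ub (P d3) (mono f) (d1 ∷ w) p)

  decompose : ∀ {m} (f : Fin m → Carrier) u →
    mono f u ≤ ⋁[ (λ w → isDk w ∧ (w ≤ⁿ u)) ] mono f
  decompose f u with has-d2 u in eq
  ... | false = ⋁[]-ub _ (mono f) u (∧-intro (no-d2-Dk u eq) (≤ⁿ-refl u))
  ... | true = begin
    mono f u                                ≡⟨ ⊓-idem (mono f u) ⟨
    mono f u ⊓ mono f u                     ≤⟨ split-d3 (mono-kleene f u eq) f u ⟩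
    ⋁[ (λ w → no-d3 w ∧ (w ≤ⁿ u)) ] mono f  ≤⟨ ⋁[]-lub _ (mono f) _ into ⟩
    ⋁[ (λ w → isDk w ∧ (w ≤ⁿ u)) ] mono f   ∎
    where
      open ≤-Reasoning
      into : ∀ w → T (no-d3 w ∧ (w ≤ⁿ u)) → mono f w ≤ ⋁[ (λ w → isDk w ∧ (w ≤ⁿ u)) ] mono f
      into w p = ⋁[]-ub _ (mono f) w (∧-intro (no-d3-Dk w (∧-fst p)) (∧-snd {no-d3 w} p))

  mono-′ : ∀ {m} f (v : Vec D m) → mono f v ′ ≤ ⋁[ (λ u → not (invⁿ u ≤ⁿ v)) ] mono f
  mono-′ f [] = ≤-trans (≡⇒≤ 𝟙′) 0≤
  mono-′ {suc m} f (c ∷ v) = begin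
    (lit (f zero) c ⊓ mono f′ v) ′       ≡⟨ ′-deMorgan _ _ ⟩
    lit (f zero) c ′ ⊔ mono f′ v ′       ≤⟨ ⊔-lub (head c) tail ⟩
    ⋁[ Q c ] mono f                      ∎
    where
      open ≤-Reasoning
      f′ = f ∘ suc
      Q = λ c u → not (invⁿ u ≤ⁿ (c ∷ v))
      single : ∀ c d → T (Q c (basis zero d)) → lit (f zero) d ≤ ⋁[ Q c ] mono f
      single c d q = ≤-trans (≡⇒≤ (sym (mono-basis f zero d))) (⋁[]-ub (Q c) (mono f) (basis zero d) q)
      head : ∀ c → lit (f zero) c ′ ≤ ⋁[ Q c ] mono f
      head d0 = single d0 d1 tt
      head d1 = ≤-trans (≡⇒≤ (′-involutive _)) (single d1 d0 tt)
      head d2 = ≤-trans (≡⇒≤ (′-deMorgan _ _))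
                  (⊔-lub (single d2 d1 tt) (≤-trans (≡⇒≤ (′-involutive _)) (single d2 d0 tt)))
      head d3 = ≤-trans (≡⇒≤ 𝟙′) 0≤
      -- x′_u = x_{3 ∷ u}, and i(3 ∷ u) ≤ c ∷ v iff i(u) ≤ v
      tail : mono f′ v ′ ≤ ⋁[ Q c ] mono f
      tail = ≤-trans (mono-′ f′ v) (⋁[]-lub _ (mono f′) _ λ u q →
               ≤-trans (⊓-glb ≤1 ≤-refl) (⋁[]-ub (Q c) (mono f) (d3 ∷ u) q))

  mono-disjoint : ∀ {m} f (v w : Vec D m) → ¬ T (invⁿ w ≤ⁿ v) → mono f v ≤ mono f w ′
  mono-disjoint f [] [] h = ⊥-elim (h tt)
  mono-disjoint f (c ∷ v) (d ∷ w) h with T? (invᴰ d ≤ᴰ c)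
  ... | no d≰c = ≤-trans ⊓-lb₁ (≤-trans (lit-disjoint (f zero) c d d≰c) (′-antitone ⊓-lb₁))
  ... | yes d≤c = ≤-trans ⊓-lb₂
        (≤-trans (mono-disjoint (f ∘ suc) v w (h ∘ ∧-intro d≤c)) (′-antitone ⊓-lb₂))

module _ {A B : KleeneAlgebra} {h : KleeneAlgebra.Carrier A → KleeneAlgebra.Carrier B}
         (hom : IsHom A B h) where
  open IsHom hom
  private
    module A = KleeneAlgebra A
    module B = KleeneAlgebra B
    module MA = Monomials A
    module MB = Monomials B

  hom-lit : ∀ a c → h (MA.lit a c) ≡ MB.lit (h a) c
  hom-lit a d0 = refl
  hom-lit a d1 = pres-′ a
  hom-lit a d2 = trans (pres-⊓ _ _) (cong (h a B.⊓_) (pres-′ a))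
  hom-lit a d3 = pres-𝟙

  hom-mono : ∀ {m} (f : Fin m → A.Carrier) v → h (MA.mono f v) ≡ MB.mono (h ∘ f) v
  hom-mono f [] = pres-𝟙
  hom-mono f (c ∷ v) = trans (pres-⊓ _ _) (cong₂ B._⊓_ (hom-lit (f zero) c) (hom-mono (f ∘ suc) v))

hom-∘ : ∀ {A B C : KleeneAlgebra} {h : KleeneAlgebra.Carrier A → KleeneAlgebra.Carrier B}
  {k : KleeneAlgebra.Carrier B → KleeneAlgebra.Carrier C} →
  IsHom A B h → IsHom B C k → IsHom A C (k ∘ h)
hom-∘ {h = h} {k} H K = record
  { pres-⊓ = λ x y → trans (cong k (pres-⊓ H x y)) (pres-⊓ K _ _)
  ; pres-⊔ = λ x y → trans (cong k (pres-⊔ H x y)) (pres-⊔ K _ _)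
  ; pres-′ = λ x → trans (cong k (pres-′ H x)) (pres-′ K _)
  ; pres-𝟘 = trans (cong k (pres-𝟘 H)) (pres-𝟘 K)
  ; pres-𝟙 = trans (cong k (pres-𝟙 H)) (pres-𝟙 K) }
  where open IsHom

hom-id : ∀ (A : KleeneAlgebra) → IsHom A A (λ x → x)
hom-id A = record { pres-⊓ = λ _ _ → refl ; pres-⊔ = λ _ _ → refl ; pres-′ = λ _ → refl
                  ; pres-𝟘 = refl ; pres-𝟙 = refl }

-- Tries

-- A function Vec D n → X stored as a 4-ary tree of depth n; functions that agree
-- pointwise have equal tries, which gives extensionality for finite subsets of Dⁿ.
Trie : Set → ℕ → Set
Trie X zero = X
Trie X (suc n) = Trie X n × Trie X n × Trie X n × Trie X n

module _ {X : Set} where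

  look : ∀ {n} → Trie X n → Vec D n → X
  look x [] = x
  look (t , _ , _ , _) (d0 ∷ v) = look t v
  look (_ , t , _ , _) (d1 ∷ v) = look t v
  look (_ , _ , t , _) (d2 ∷ v) = look t v
  look (_ , _ , _ , t) (d3 ∷ v) = look t v

  tabulate : ∀ {n} → (Vec D n → X) → Trie X n
  tabulate {zero} f = f []
  tabulate {suc n} f = part d0 , part d1 , part d2 , part d3
    where part = λ c → tabulate (λ v → f (c ∷ v))

  look-tabulate : ∀ {n} (f : Vec D n → X) v → look (tabulate f) v ≡ f v
  look-tabulate f [] = refl
  look-tabulate f (d0 ∷ v) = look-tabulate (λ v → f (d0 ∷ v)) v
  look-tabulate f (d1 ∷ v) = look-tabulate (λ v → f (d1 ∷ v)) v
  look-tabulate f (d2 ∷ v) = look-tabulate (λ v → f (d2 ∷ v)) v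
  look-tabulate f (d3 ∷ v) = look-tabulate (λ v → f (d3 ∷ v)) v

  trie-ext : ∀ {n} (s t : Trie X n) → (∀ v → look s v ≡ look t v) → s ≡ t
  trie-ext {zero} s t p = p []
  trie-ext {suc n} (s₀ , s₁ , s₂ , s₃) (t₀ , t₁ , t₂ , t₃) p =
    cong₂ _,_ (trie-ext s₀ t₀ (λ v → p (d0 ∷ v)))
      (cong₂ _,_ (trie-ext s₁ t₁ (λ v → p (d1 ∷ v)))
        (cong₂ _,_ (trie-ext s₂ t₂ (λ v → p (d2 ∷ v))) (trie-ext s₃ t₃ (λ v → p (d3 ∷ v)))))

-- The Kleene algebra of down-sets of (Dⁿ)_k

module Downsets (n : ℕ) where

  allⁿ : (Vec D n → Bool) → Bool
  allⁿ = fold _∧_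

  allⁿ-intro : ∀ p → (∀ v → T (p v)) → T (allⁿ p)
  allⁿ-intro p h =
    fold-lub _∧_ (λ a c → T c → T a) (λ p q t → ∧-intro (p t) (q t)) p true (λ v _ → h v) tt

  allⁿ-elim : ∀ p → T (allⁿ p) → ∀ v → T (p v)
  allⁿ-elim p h v =
    fold-ub _∧_ (λ a b → T b → T a) (λ t → t) (λ p q → p ∘ q) ∧-fst (λ {a} → ∧-snd {a}) p v h

  isDownset : Trie Bool n → Bool
  isDownset s = allⁿ λ v →
    (look s v ⇒ isDk v) ∧ allⁿ λ u → (isDk u ∧ (u ≤ⁿ v)) ∧ look s v ⇒ look s u

  Downset : Set
  Downset = Σ (Trie Bool n) (T ∘ isDownset)

  ⟦_⟧ : Downset → Vec D n → Bool
  ⟦ S ⟧ = look (proj₁ S)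

  infix 4 _∈_
  _∈_ : Vec D n → Downset → Set
  v ∈ S = T (⟦ S ⟧ v)

  ∈-Dk : ∀ S v → v ∈ S → T (isDk v)
  ∈-Dk (s , ok) v = ⇒-elim (∧-fst (allⁿ-elim _ ok v))

  ∈-down : ∀ S u v → T (isDk u) → T (u ≤ⁿ v) → v ∈ S → u ∈ S
  ∈-down (s , ok) u v du le p =
    ⇒-elim (allⁿ-elim _ (∧-snd {look s v ⇒ isDk v} (allⁿ-elim _ ok v)) u) (∧-intro (∧-intro du le) p)

  downset-ext : ∀ {S S′} → (∀ v → ⟦ S ⟧ v ≡ ⟦ S′ ⟧ v) → S ≡ S′
  downset-ext {s , p} {t , q} h with trie-ext s t h
  ... | refl = cong (s ,_) (T-irrelevant p q)

  downset : (p : Vec D n → Bool) → (∀ v → T (p v) → T (isDk v)) →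
    (∀ u v → T (isDk u) → T (u ≤ⁿ v) → T (p v) → T (p u)) → Downset
  downset p inDk down = tabulate p , allⁿ-intro _ λ v →
    ∧-intro (⇒-intro (inDk v ∘ from v)) (allⁿ-intro _ λ u → ⇒-intro λ q →
      to u (down u v (∧-fst (∧-fst q)) (∧-snd {isDk u} (∧-fst q))
                     (from v (∧-snd {isDk u ∧ (u ≤ⁿ v)} q))))
    where
      from = λ v → subst T (look-tabulate p v)
      to   = λ v → subst T (sym (look-tabulate p v))

  infixr 7 _∩_
  infixr 6 _∪_
  _∩_ _∪_ : Downset → Downset → Downset
  S ∩ S′ = downset (λ v → ⟦ S ⟧ v ∧ ⟦ S′ ⟧ v) (λ v p → ∈-Dk S v (∧-fst p))
    (λ u v du le p →
      ∧-intro (∈-down S u v du le (∧-fst p)) (∈-down S′ u v du le (∧-snd {⟦ S ⟧ v} p)))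
  S ∪ S′ = downset (λ v → ⟦ S ⟧ v ∨ ⟦ S′ ⟧ v) (λ v p → [ ∈-Dk S v , ∈-Dk S′ v ] (∨-elim p))
    (λ u v du le p →
      [ ∨-inl ∘ ∈-down S u v du le , ∨-inr {⟦ S ⟧ u} ∘ ∈-down S′ u v du le ] (∨-elim p))

  _ᶜ : Downset → Downset
  S ᶜ = downset (λ v → isDk v ∧ not (⟦ S ⟧ (invⁿ v))) (λ v p → ∧-fst p)
    (λ u v du le p → ∧-intro du (not-intro
      (not-elim (∧-snd {isDk v} p) ∘
        ∈-down S (invⁿ v) (invⁿ u) (Dk-invⁿ v (∧-fst {isDk v} p)) (invⁿ-antitone u v le))))

  ∅ full : Downset
  ∅ = downset (λ _ → false) (λ _ ()) (λ _ _ _ _ ())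
  full = downset isDk (λ _ p → p) (λ _ _ du _ _ → du)

  ⟦∩⟧ : ∀ S S′ v → ⟦ S ∩ S′ ⟧ v ≡ ⟦ S ⟧ v ∧ ⟦ S′ ⟧ v
  ⟦∩⟧ S S′ = look-tabulate _

  ⟦∪⟧ : ∀ S S′ v → ⟦ S ∪ S′ ⟧ v ≡ ⟦ S ⟧ v ∨ ⟦ S′ ⟧ v
  ⟦∪⟧ S S′ = look-tabulate _

  ⟦ᶜ⟧ : ∀ S v → ⟦ S ᶜ ⟧ v ≡ isDk v ∧ not (⟦ S ⟧ (invⁿ v))
  ⟦ᶜ⟧ S = look-tabulate _

  ⟦∅⟧ : ∀ v → ⟦ ∅ ⟧ v ≡ false
  ⟦∅⟧ = look-tabulate _

  ⟦full⟧ : ∀ v → ⟦ full ⟧ v ≡ isDk v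
  ⟦full⟧ = look-tabulate _

  ∩-assoc : ∀ S S′ S″ → (S ∩ S′) ∩ S″ ≡ S ∩ (S′ ∩ S″)
  ∩-assoc S S′ S″ = downset-ext pointwise
    where
      pointwise : ∀ v → ⟦ (S ∩ S′) ∩ S″ ⟧ v ≡ ⟦ S ∩ (S′ ∩ S″) ⟧ v
      pointwise v rewrite ⟦∩⟧ (S ∩ S′) S″ v | ⟦∩⟧ S S′ v | ⟦∩⟧ S (S′ ∩ S″) v | ⟦∩⟧ S′ S″ v
        = ∧-assoc (⟦ S ⟧ v) (⟦ S′ ⟧ v) (⟦ S″ ⟧ v)

  ∪-assoc : ∀ S S′ S″ → (S ∪ S′) ∪ S″ ≡ S ∪ (S′ ∪ S″)
  ∪-assoc S S′ S″ = downset-ext pointwise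
    where
      pointwise : ∀ v → ⟦ (S ∪ S′) ∪ S″ ⟧ v ≡ ⟦ S ∪ (S′ ∪ S″) ⟧ v
      pointwise v rewrite ⟦∪⟧ (S ∪ S′) S″ v | ⟦∪⟧ S S′ v | ⟦∪⟧ S (S′ ∪ S″) v | ⟦∪⟧ S′ S″ v
        = ∨-assoc (⟦ S ⟧ v) (⟦ S′ ⟧ v) (⟦ S″ ⟧ v)

  ∩-comm : ∀ S S′ → S ∩ S′ ≡ S′ ∩ S
  ∩-comm S S′ = downset-ext pointwise
    where
      pointwise : ∀ v → ⟦ S ∩ S′ ⟧ v ≡ ⟦ S′ ∩ S ⟧ v
      pointwise v rewrite ⟦∩⟧ S S′ v | ⟦∩⟧ S′ S v = ∧-comm (⟦ S ⟧ v) (⟦ S′ ⟧ v)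

  ∪-comm : ∀ S S′ → S ∪ S′ ≡ S′ ∪ S
  ∪-comm S S′ = downset-ext pointwise
    where
      pointwise : ∀ v → ⟦ S ∪ S′ ⟧ v ≡ ⟦ S′ ∪ S ⟧ v
      pointwise v rewrite ⟦∪⟧ S S′ v | ⟦∪⟧ S′ S v = ∨-comm (⟦ S ⟧ v) (⟦ S′ ⟧ v)

  ∩-absorbs-∪ : ∀ S S′ → S ∩ (S ∪ S′) ≡ S
  ∩-absorbs-∪ S S′ = downset-ext pointwise
    where
      pointwise : ∀ v → ⟦ S ∩ (S ∪ S′) ⟧ v ≡ ⟦ S ⟧ v
      pointwise v rewrite ⟦∩⟧ S (S ∪ S′) v | ⟦∪⟧ S S′ v = ∧-abs-∨ (⟦ S ⟧ v) (⟦ S′ ⟧ v)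

  ∪-absorbs-∩ : ∀ S S′ → S ∪ (S ∩ S′) ≡ S
  ∪-absorbs-∩ S S′ = downset-ext pointwise
    where
      pointwise : ∀ v → ⟦ S ∪ (S ∩ S′) ⟧ v ≡ ⟦ S ⟧ v
      pointwise v rewrite ⟦∪⟧ S (S ∩ S′) v | ⟦∩⟧ S S′ v = ∨-abs-∧ (⟦ S ⟧ v) (⟦ S′ ⟧ v)

  ∩-distrib-∪ : ∀ S S′ S″ → S ∩ (S′ ∪ S″) ≡ (S ∩ S′) ∪ (S ∩ S″)
  ∩-distrib-∪ S S′ S″ = downset-ext pointwise
    where
      pointwise : ∀ v → ⟦ S ∩ (S′ ∪ S″) ⟧ v ≡ ⟦ (S ∩ S′) ∪ (S ∩ S″) ⟧ v
      pointwise v rewrite ⟦∩⟧ S (S′ ∪ S″) v | ⟦∪⟧ S′ S″ v | ⟦∪⟧ (S ∩ S′) (S ∩ S″) v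
                        | ⟦∩⟧ S S′ v | ⟦∩⟧ S S″ v
        = ∧-distribˡ-∨ (⟦ S ⟧ v) (⟦ S′ ⟧ v) (⟦ S″ ⟧ v)

  ∩-identity : ∀ S → S ∩ full ≡ S
  ∩-identity S = downset-ext pointwise
    where
      pointwise : ∀ v → ⟦ S ∩ full ⟧ v ≡ ⟦ S ⟧ v
      pointwise v rewrite ⟦∩⟧ S full v | ⟦full⟧ v = ∧-absorb (⟦ S ⟧ v) (isDk v) (∈-Dk S v)

  ∪-identity : ∀ S → S ∪ ∅ ≡ S
  ∪-identity S = downset-ext pointwise
    where
      pointwise : ∀ v → ⟦ S ∪ ∅ ⟧ v ≡ ⟦ S ⟧ v
      pointwise v rewrite ⟦∪⟧ S ∅ v | ⟦∅⟧ v = ∨-identityʳ (⟦ S ⟧ v)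

  ᶜ-involutive : ∀ S → (S ᶜ) ᶜ ≡ S
  ᶜ-involutive S = downset-ext pointwise
    where
      double-not : ∀ d x → (T x → T d) → d ∧ not (d ∧ not x) ≡ x
      double-not true  x     _ = not-involutive x
      double-not false false _ = refl
      double-not false true  h = ⊥-elim (h tt)
      pointwise : ∀ v → ⟦ (S ᶜ) ᶜ ⟧ v ≡ ⟦ S ⟧ v
      pointwise v rewrite ⟦ᶜ⟧ (S ᶜ) v | ⟦ᶜ⟧ S (invⁿ v) | isDk-invⁿ v | invⁿ-involutive v
        = double-not (isDk v) (⟦ S ⟧ v) (∈-Dk S v)

  ᶜ-deMorgan : ∀ S S′ → (S ∩ S′) ᶜ ≡ (S ᶜ) ∪ (S′ ᶜ)
  ᶜ-deMorgan S S′ = downset-ext pointwise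
    where
      deMorgan : ∀ d x y → d ∧ not (x ∧ y) ≡ (d ∧ not x) ∨ (d ∧ not y)
      deMorgan true  true  y = refl
      deMorgan true  false y = refl
      deMorgan false x     y = refl
      pointwise : ∀ v → ⟦ (S ∩ S′) ᶜ ⟧ v ≡ ⟦ (S ᶜ) ∪ (S′ ᶜ) ⟧ v
      pointwise v rewrite ⟦ᶜ⟧ (S ∩ S′) v | ⟦∩⟧ S S′ (invⁿ v) | ⟦∪⟧ (S ᶜ) (S′ ᶜ) v
                        | ⟦ᶜ⟧ S v | ⟦ᶜ⟧ S′ v
        = deMorgan (isDk v) (⟦ S ⟧ (invⁿ v)) (⟦ S′ ⟧ (invⁿ v))

  -- If v ∈ S and i(v) ∉ S then v ≤ i(v) (otherwise i(v) ∈ S by down-closure),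
  -- so v ∈ S′ or i(v) ∉ S′ for every S′: this is the Kleene inequality.
  kleene-pointwise : ∀ S S′ v → v ∈ S → ¬ invⁿ v ∈ S →
    T (⟦ S′ ⟧ v ∨ (isDk v ∧ not (⟦ S′ ⟧ (invⁿ v))))
  kleene-pointwise S S′ v v∈S iv∉S with ∨-elim (∈-Dk S v v∈S)
  ... | inj₂ iv≤v = ⊥-elim (iv∉S (∈-down S (invⁿ v) v (Dk-invⁿ v (∈-Dk S v v∈S)) iv≤v v∈S))
  ... | inj₁ v≤iv with T? (⟦ S′ ⟧ (invⁿ v))
  ...   | yes iv∈S′ = ∨-inl (∈-down S′ v (invⁿ v) (∈-Dk S v v∈S) v≤iv iv∈S′)
  ...   | no iv∉S′  = ∨-inr {⟦ S′ ⟧ v} (∧-intro (∈-Dk S v v∈S) (not-intro iv∉S′))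

  ᶜ-kleene : ∀ S S′ → (S ∩ (S ᶜ)) ∩ (S′ ∪ (S′ ᶜ)) ≡ S ∩ (S ᶜ)
  ᶜ-kleene S S′ = downset-ext pointwise
    where
      pointwise : ∀ v → ⟦ (S ∩ (S ᶜ)) ∩ (S′ ∪ (S′ ᶜ)) ⟧ v ≡ ⟦ S ∩ (S ᶜ) ⟧ v
      pointwise v rewrite ⟦∩⟧ (S ∩ (S ᶜ)) (S′ ∪ (S′ ᶜ)) v | ⟦∩⟧ S (S ᶜ) v | ⟦ᶜ⟧ S v
                        | ⟦∪⟧ S′ (S′ ᶜ) v | ⟦ᶜ⟧ S′ v
        = ∧-absorb _ _ λ p → kleene-pointwise S S′ v (∧-fst p)
            (not-elim (∧-snd {isDk v} (∧-snd {⟦ S ⟧ v} p)))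

  algebra : KleeneAlgebra
  algebra = record
    { Carrier = Downset ; _⊓_ = _∩_ ; _⊔_ = _∪_ ; _′ = _ᶜ ; 𝟘 = ∅ ; 𝟙 = full
    ; ⊓-assoc = ∩-assoc ; ⊔-assoc = ∪-assoc ; ⊓-comm = ∩-comm ; ⊔-comm = ∪-comm
    ; ⊓-absorbs-⊔ = ∩-absorbs-∪ ; ⊔-absorbs-⊓ = ∪-absorbs-∩ ; ⊓-distrib-⊔ = ∩-distrib-∪
    ; ⊓-identity = ∩-identity ; ⊔-identity = ∪-identity
    ; ′-involutive = ᶜ-involutive ; ′-deMorgan = ᶜ-deMorgan ; kleene = ᶜ-kleene }

  ∈-∩⁻ : ∀ S S′ v → v ∈ S ∩ S′ → v ∈ S × v ∈ S′
  ∈-∩⁻ S S′ v p = let q = subst T (⟦∩⟧ S S′ v) p in ∧-fst q , ∧-snd {⟦ S ⟧ v} q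

  ∈-∩⁺ : ∀ S S′ v → v ∈ S → v ∈ S′ → v ∈ S ∩ S′
  ∈-∩⁺ S S′ v p q = subst T (sym (⟦∩⟧ S S′ v)) (∧-intro p q)

  ∈-∪⁻ : ∀ S S′ v → v ∈ S ∪ S′ → v ∈ S ⊎ v ∈ S′
  ∈-∪⁻ S S′ v p = ∨-elim (subst T (⟦∪⟧ S S′ v) p)

  ∈-∪ˡ : ∀ S S′ v → v ∈ S → v ∈ S ∪ S′
  ∈-∪ˡ S S′ v p = subst T (sym (⟦∪⟧ S S′ v)) (∨-inl p)

  ∈-∪ʳ : ∀ S S′ v → v ∈ S′ → v ∈ S ∪ S′
  ∈-∪ʳ S S′ v p = subst T (sym (⟦∪⟧ S S′ v)) (∨-inr {⟦ S ⟧ v} p)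

  ∈-ᶜ⁻ : ∀ S v → v ∈ S ᶜ → ¬ invⁿ v ∈ S
  ∈-ᶜ⁻ S v p = not-elim (∧-snd {isDk v} (subst T (⟦ᶜ⟧ S v) p))

  ∈-ᶜ⁺ : ∀ S v → T (isDk v) → ¬ invⁿ v ∈ S → v ∈ S ᶜ
  ∈-ᶜ⁺ S v dv p = subst T (sym (⟦ᶜ⟧ S v)) (∧-intro dv (not-intro p))

  ∉-∅ : ∀ v → ¬ v ∈ ∅
  ∉-∅ v p = subst T (⟦∅⟧ v) p

  ∈-full : ∀ v → T (isDk v) → v ∈ full
  ∈-full v = subst T (sym (⟦full⟧ v))

  ⋂ : ∀ {m} → (Vec D m → Downset) → Downset
  ⋂ = fold _∩_

  ⋂-elim : ∀ {m} (H : Vec D m → Downset) v z → z ∈ ⋂ H → z ∈ H v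
  ⋂-elim H v z = fold-ub _∩_ (λ S S′ → ∀ z → z ∈ S′ → z ∈ S) (λ _ p → p)
    (λ p q z → p z ∘ q z) (λ {S} {S′} z → proj₁ ∘ ∈-∩⁻ S S′ z) (λ {S} {S′} z → proj₂ ∘ ∈-∩⁻ S S′ z)
    H v z

  open Monomials algebra public using () renaming (lit to litᴮ; mono to monoᴮ)

  ∈-mono⁻ : ∀ {m} (f : Fin m → Downset) w z → z ∈ monoᴮ f w → ∀ i → z ∈ litᴮ (f i) (lookup w i)
  ∈-mono⁻ f (c ∷ w) z p zero = proj₁ (∈-∩⁻ (litᴮ (f zero) c) (monoᴮ (f ∘ suc) w) z p)
  ∈-mono⁻ f (c ∷ w) z p (suc i) =
    ∈-mono⁻ (f ∘ suc) w z (proj₂ (∈-∩⁻ (litᴮ (f zero) c) (monoᴮ (f ∘ suc) w) z p)) i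

  ∈-mono⁺ : ∀ {m} (f : Fin m → Downset) w z → T (isDk z) →
    (∀ i → z ∈ litᴮ (f i) (lookup w i)) → z ∈ monoᴮ f w
  ∈-mono⁺ f [] z dz _ = ∈-full z dz
  ∈-mono⁺ f (c ∷ w) z dz p =
    ∈-∩⁺ (litᴮ (f zero) c) (monoᴮ (f ∘ suc) w) z (p zero) (∈-mono⁺ (f ∘ suc) w z dz (p ∘ suc))

-- The free Kleene algebra F on the generators g

module FreeKleene (n : ℕ) (F : KleeneAlgebra) (g : Fin n → KleeneAlgebra.Carrier F)
                  (free : IsFreeKleene n F g) where
  open KleeneAlgebra F
  open KleeneOrder F
  open Monomials F
  open Downsets n

  x : Vec D n → Carrier
  x = mono g

  k : Downset → Carrier
  k S = ⋁[ ⟦ S ⟧ ] x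

  k-ub : ∀ S v → v ∈ S → x v ≤ k S
  k-ub S = ⋁[]-ub ⟦ S ⟧ x

  k-lub : ∀ S c → (∀ v → v ∈ S → x v ≤ c) → k S ≤ c
  k-lub S = ⋁[]-lub ⟦ S ⟧ x

  k-mono : ∀ S S′ → (∀ v → v ∈ S → v ∈ S′) → k S ≤ k S′
  k-mono S S′ sub = k-lub S (k S′) λ v p → k-ub S′ v (sub v p)

  -- x_u ≤ k(S) as soon as S contains every element of (Dⁿ)_k below u; this is
  -- where the Kleene inequality of F is used (through decompose).
  x≤k : ∀ S u → (∀ z → T (isDk z) → T (z ≤ⁿ u) → z ∈ S) → x u ≤ k S
  x≤k S u below = ≤-trans (decompose g u)
    (⋁[]-lub _ x (k S) λ z p → k-ub S z (below z (∧-fst p) (∧-snd {isDk z} p)))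

  k-∩ : ∀ S S′ → k (S ∩ S′) ≡ k S ⊓ k S′
  k-∩ S S′ = ≤-antisym
    (k-lub (S ∩ S′) _ λ v p → let (p₁ , p₂) = ∈-∩⁻ S S′ v p in ⊓-glb (k-ub S v p₁) (k-ub S′ v p₂))
    (⋁[]-⊓-lub ⟦ S′ ⟧ x (k S) _ λ w w∈S′ → ≤-trans ⊓-comm-≤
      (⋁[]-⊓-lub ⟦ S ⟧ x (x w) _ λ v v∈S → ≤-trans (mono-meet g w v)
        (x≤k (S ∩ S′) (meetⁿ w v) λ z dz z≤wv →
          ∈-∩⁺ S S′ z (∈-down S z v dz (≤ⁿ-trans z _ v z≤wv (meetⁿ-lb₂ w v)) v∈S)
                      (∈-down S′ z w dz (≤ⁿ-trans z _ w z≤wv (meetⁿ-lb₁ w v)) w∈S′))))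

  k-∪ : ∀ S S′ → k (S ∪ S′) ≡ k S ⊔ k S′
  k-∪ S S′ = ≤-antisym
    (k-lub (S ∪ S′) _ λ v p →
      [ (λ q → ≤-trans (k-ub S v q) ⊔-ub₁) , (λ q → ≤-trans (k-ub S′ v q) ⊔-ub₂) ] (∈-∪⁻ S S′ v p))
    (⊔-lub (k-mono S (S ∪ S′) (∈-∪ˡ S S′)) (k-mono S′ (S ∪ S′) (∈-∪ʳ S S′)))

  k-∅ : k ∅ ≡ 𝟘
  k-∅ = ≤-antisym (k-lub ∅ 𝟘 λ v p → ⊥-elim (∉-∅ v p)) 0≤

  k-full : k full ≡ 𝟙
  k-full = ≤-antisym ≤1 (≤-trans (≡⇒≤ (sym (mono-top g)))
    (k-ub full (top n) (∈-full (top n) (top-Dk n))))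

  avoiding : Downset → Vec D n → Downset
  avoiding S v = downset (λ u → isDk u ∧ (⟦ S ⟧ v ⇒ not (invⁿ u ≤ⁿ v))) (λ u p → ∧-fst p)
    λ u u′ du le p → ∧-intro du (⇒-intro λ v∈S → not-intro λ iu≤v →
      not-elim (⇒-elim (∧-snd {isDk u′} p) v∈S)
        (≤ⁿ-trans (invⁿ u′) (invⁿ u) v (invⁿ-antitone u u′ le) iu≤v))

  ∈-avoiding⁺ : ∀ S v u → T (isDk u) → (v ∈ S → ¬ T (invⁿ u ≤ⁿ v)) → u ∈ avoiding S v
  ∈-avoiding⁺ S v u du h = subst T (sym (look-tabulate _ u)) (∧-intro du (⇒-intro (not-intro ∘ h)))

  ∈-avoiding⁻ : ∀ S v u → u ∈ avoiding S v → T (isDk u) × (v ∈ S → ¬ T (invⁿ u ≤ⁿ v))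
  ∈-avoiding⁻ S v u p =
    let q = subst T (look-tabulate _ u) p in ∧-fst q , not-elim ∘ ⇒-elim (∧-snd {isDk u} q)

  -- (k S)′ ≤ k (avoiding S v): for v ∈ S this is (k S)′ ≤ x_v′ ≤ ⋁_{i(u) ≰ v} x_u.
  ′k≤k-avoiding : ∀ S v → k S ′ ≤ k (avoiding S v)
  ′k≤k-avoiding S v with T? (⟦ S ⟧ v)
  ... | yes v∈S = ≤-trans (′-antitone (k-ub S v v∈S)) (≤-trans (mono-′ g v)
        (⋁[]-lub _ x _ λ u iu≰v → x≤k (avoiding S v) u λ z dz z≤u →
          ∈-avoiding⁺ S v z dz λ _ iz≤v →
            not-elim iu≰v (≤ⁿ-trans (invⁿ u) (invⁿ z) v (invⁿ-antitone z u z≤u) iz≤v)))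
  ... | no v∉S = ≤-trans ≤1 (≤-trans (≡⇒≤ (sym (mono-top g)))
        (x≤k (avoiding S v) (top n) λ z dz _ → ∈-avoiding⁺ S v z dz (⊥-elim ∘ v∉S)))

  -- Every z in all the avoiding S v has i(z) ∉ S (take v = i(z)).
  ⋂-avoiding⊆ᶜ : ∀ S z → z ∈ ⋂ (avoiding S) → z ∈ S ᶜ
  ⋂-avoiding⊆ᶜ S z p = ∈-ᶜ⁺ S z dz λ iz∈S → avoid iz∈S (≤ⁿ-refl (invⁿ z))
    where
      dz-avoid = ∈-avoiding⁻ S (invⁿ z) z (⋂-elim (avoiding S) (invⁿ z) z p)
      dz = proj₁ dz-avoid
      avoid = proj₂ dz-avoid

  k-ᶜ : ∀ S → k (S ᶜ) ≡ k S ′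
  k-ᶜ S = ≤-antisym
    (k-lub (S ᶜ) _ λ w w∈Sᶜ → ′-swap (k-lub S _ λ v v∈S → mono-disjoint g v w λ iw≤v →
      ∈-ᶜ⁻ S w w∈Sᶜ (∈-down S (invⁿ w) v (Dk-invⁿ w (∈-Dk (S ᶜ) w w∈Sᶜ)) iw≤v v∈S)))
    (begin
      k S ′                  ≤⟨ ⋀-glb (k ∘ avoiding S) _ (′k≤k-avoiding S) ⟩
      ⋀ (k ∘ avoiding S)     ≡⟨ fold-hom _∩_ _⊓_ k k-∩ (avoiding S) ⟨
      k (⋂ (avoiding S))     ≤⟨ k-mono (⋂ (avoiding S)) (S ᶜ) (⋂-avoiding⊆ᶜ S) ⟩
      k (S ᶜ)                ∎)
    where open ≤-Reasoning

  k-hom : IsHom algebra F k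
  k-hom = record { pres-⊓ = k-∩ ; pres-⊔ = k-∪ ; pres-′ = k-ᶜ ; pres-𝟘 = k-∅ ; pres-𝟙 = k-full }

  Gen : Fin n → Downset
  Gen i = downset (λ w → isDk w ∧ (lookup w i ≤ᴰ d0)) (λ w p → ∧-fst p)
    λ u w du le p → ∧-intro du (≤ᴰ-trans _ _ d0 (≤ⁿ-lookup u w i le) (∧-snd {isDk w} p))

  ⟦Gen⟧ : ∀ i w → ⟦ Gen i ⟧ w ≡ isDk w ∧ (lookup w i ≤ᴰ d0)
  ⟦Gen⟧ i = look-tabulate _

  k-Gen : ∀ i → k (Gen i) ≡ g i
  k-Gen i = ≤-antisym
    (k-lub (Gen i) _ λ w p →
      ≤-trans (mono-lit g w i) (lit-mono (g i) _ d0 (∧-snd {isDk w} (subst T (⟦Gen⟧ i w) p))))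
    (begin
      g i               ≡⟨ mono-basis g i d0 ⟨
      x (basis i d0)    ≤⟨ x≤k (Gen i) (basis i d0) below ⟩
      k (Gen i)         ∎)
    where
      open ≤-Reasoning
      below : ∀ z → T (isDk z) → T (z ≤ⁿ basis i d0) → z ∈ Gen i
      below z dz le = subst T (sym (⟦Gen⟧ i z)) (∧-intro dz
        (subst (λ c → T (lookup z i ≤ᴰ c)) (lookup∘update i (top n) d0) (≤ⁿ-lookup z _ i le)))

  ⟦lit-Gen⟧ : ∀ i c v → ⟦ litᴮ (Gen i) c ⟧ v ≡ isDk v ∧ (lookup v i ≤ᴰ c)
  ⟦lit-Gen⟧ i d0 v = ⟦Gen⟧ i v
  ⟦lit-Gen⟧ i d1 v rewrite ⟦ᶜ⟧ (Gen i) v | ⟦Gen⟧ i (invⁿ v) | isDk-invⁿ v | lookup-invⁿ v i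
    = complement (isDk v) (lookup v i)
    where
      complement : ∀ d c → d ∧ not (d ∧ (invᴰ c ≤ᴰ d0)) ≡ d ∧ (c ≤ᴰ d1)
      complement false _  = refl
      complement true  d0 = refl
      complement true  d1 = refl
      complement true  d2 = refl
      complement true  d3 = refl
  ⟦lit-Gen⟧ i d2 v rewrite ⟦∩⟧ (Gen i) (Gen i ᶜ) v | ⟦lit-Gen⟧ i d0 v | ⟦lit-Gen⟧ i d1 v
    = meet (isDk v) (lookup v i)
    where
      meet : ∀ d c → (d ∧ (c ≤ᴰ d0)) ∧ (d ∧ (c ≤ᴰ d1)) ≡ d ∧ (c ≤ᴰ d2)
      meet false _  = refl
      meet true  d0 = refl
      meet true  d1 = refl
      meet true  d2 = refl
      meet true  d3 = refl
  ⟦lit-Gen⟧ i d3 v rewrite ⟦full⟧ v = top-literal (isDk v) (lookup v i)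
    where
      top-literal : ∀ d c → d ≡ d ∧ (c ≤ᴰ d3)
      top-literal false _  = refl
      top-literal true  d0 = refl
      top-literal true  d1 = refl
      top-literal true  d2 = refl
      top-literal true  d3 = refl

  -- The homomorphism Φ : F → down-sets with Φ(gᵢ) = Genᵢ; k ∘ Φ = id by uniqueness.
  Φ : Carrier → Downset
  Φ = proj₁ (free algebra Gen)

  Φ-hom : IsHom F algebra Φ
  Φ-hom = proj₁ (proj₂ (free algebra Gen))

  Φ-g : ∀ i → Φ (g i) ≡ Gen i
  Φ-g = proj₁ (proj₂ (proj₂ (free algebra Gen)))

  k∘Φ : ∀ a → k (Φ a) ≡ a
  k∘Φ a = trans (unique (k ∘ Φ) (hom-∘ Φ-hom k-hom) (λ i → trans (cong k (Φ-g i)) (k-Gen i)) a)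
                (sym (unique (λ y → y) (hom-id F) (λ _ → refl) a))
    where unique = proj₂ (proj₂ (proj₂ (free F g)))

  ∈Φ⇒≤ : ∀ a v → v ∈ Φ a → x v ≤ a
  ∈Φ⇒≤ a v p = ≤-trans (k-ub (Φ a) v p) (≡⇒≤ (k∘Φ a))

  Φ-mono : ∀ a b → a ≤ b → ∀ v → v ∈ Φ a → v ∈ Φ b
  Φ-mono a b a≤b v p =
    proj₂ (∈-∩⁻ (Φ a) (Φ b) v (subst (v ∈_) (trans (cong Φ (sym a≤b)) (IsHom.pres-⊓ Φ-hom a b)) p))

  ∈Φx⇒≤ : ∀ w v → v ∈ Φ (x w) → T (v ≤ⁿ w)
  ∈Φx⇒≤ w v p = lookup-≤ⁿ v w λ i → ∧-snd {isDk v} (subst T (⟦lit-Gen⟧ i (lookup w i) v)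
    (subst (λ S → v ∈ litᴮ S (lookup w i)) (Φ-g i)
      (∈-mono⁻ (Φ ∘ g) w v (subst (v ∈_) (hom-mono Φ-hom g w) p) i)))

  ∈Φx : ∀ v → T (isDk v) → v ∈ Φ (x v)
  ∈Φx v dv = subst (v ∈_) (sym (hom-mono Φ-hom g v)) (∈-mono⁺ (Φ ∘ g) v v dv λ i →
    subst (λ S → v ∈ litᴮ S (lookup v i)) (sym (Φ-g i))
      (subst T (sym (⟦lit-Gen⟧ i (lookup v i) v)) (∧-intro dv (≤ᴰ-refl (lookup v i)))))

  ≤⇒∈Φ : ∀ a v → T (isDk v) → x v ≤ a → v ∈ Φ a
  ≤⇒∈Φ a v dv le = Φ-mono (x v) a le v (∈Φx v dv)

  x-reflects : ∀ v w → T (isDk v) → x v ≤ x w → T (v ≤ⁿ w)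
  x-reflects v w dv le = ∈Φx⇒≤ w v (≤⇒∈Φ (x w) v dv le)

  x-injective : ∀ v w → T (isDk v) → T (isDk w) → x v ≡ x w → v ≡ w
  x-injective v w dv dw e =
    ≤ⁿ-antisym v w (x-reflects v w dv (≡⇒≤ e)) (x-reflects w v dw (≡⇒≤ (sym e)))

  x-irreducible : ∀ v → T (isDk v) → JoinIrreducible F (x v)
  x-irreducible v dv = nonzero , prime
    where
      in-Φ : ∀ {a} → x v ≡ a → v ∈ Φ a
      in-Φ e = subst (λ a → v ∈ Φ a) e (∈Φx v dv)
      nonzero : ¬ x v ≡ 𝟘
      nonzero e = ∉-∅ v (subst (v ∈_) (IsHom.pres-𝟘 Φ-hom) (in-Φ e))
      prime : ∀ a b → x v ≡ a ⊔ b → x v ≡ a ⊎ x v ≡ b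
      prime a b e = [ (λ p → inj₁ (≤-antisym (∈Φ⇒≤ a v p) (≤-trans ⊔-ub₁ (≡⇒≤ (sym e)))))
                    , (λ p → inj₂ (≤-antisym (∈Φ⇒≤ b v p) (≤-trans ⊔-ub₂ (≡⇒≤ (sym e))))) ]
        (∈-∪⁻ (Φ a) (Φ b) v (subst (v ∈_) (IsHom.pres-⊔ Φ-hom a b) (in-Φ e)))

  -- … and every join-irreducible y is one of them, since y = ⋁_{v ∈ Φ(y)} x_v.
  irreducible⇒x : ∀ y → JoinIrreducible F y → Σ (Vec D n) λ v → T (isDk v) × y ≡ x v
  irreducible⇒x y (nonzero , prime) with fold-irreducible _⊔_ prime _ (sym (k∘Φ y))
  ... | v , e = selected (⟦ Φ y ⟧ v) refl e
    where
      selected : ∀ b → ⟦ Φ y ⟧ v ≡ b → y ≡ (if b then x v else 𝟘) →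
        Σ (Vec D n) λ v → T (isDk v) × y ≡ x v
      selected true  v∈Φy e′ = v , ∈-Dk (Φ y) v (subst T (sym v∈Φy) tt) , e′
      selected false _    e′ = ⊥-elim (nonzero e′)

  x-involution : ∀ v → T (isDk v) → IsMeet F (Excl F (x v)) (x (invⁿ v))
  x-involution v dv = lower , λ z bound → bound (x (invⁿ v)) excluded
    where
      -- if i(v) ∉ Φ(c) then v ∈ Φ(c′), i.e. x_v ≤ c′
      lower : ∀ c → Excl F (x v) c → x (invⁿ v) ≤ c
      lower c excl with T? (⟦ Φ c ⟧ (invⁿ v))
      ... | yes iv∈Φc = ∈Φ⇒≤ c (invⁿ v) iv∈Φc
      ... | no iv∉Φc = ⊥-elim (excl (c ′) (∈Φ⇒≤ (c ′) v v∈Φc′) (sym (′-involutive c)))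
        where v∈Φc′ = subst (v ∈_) (sym (IsHom.pres-′ Φ-hom c)) (∈-ᶜ⁺ (Φ c) v dv iv∉Φc)
      -- if x_v ≤ b then v ∈ Φ(b), so i(v) ∉ Φ(b′) = Φ(x_{i(v)})
      excluded : Excl F (x v) (x (invⁿ v))
      excluded b x≤b e = ∈-ᶜ⁻ (Φ b) (invⁿ v) iv∈Φb′
          (subst (_∈ Φ b) (sym (invⁿ-involutive v)) (≤⇒∈Φ b v dv x≤b))
        where
          iv∈Φb′ = subst (invⁿ v ∈_) (trans (cong Φ e) (IsHom.pres-′ Φ-hom b))
                         (∈Φx (invⁿ v) (Dk-invⁿ v dv))

  toDk : JK F → Dk n
  toDk (y , J) = let (v , dv , _) = irreducible⇒x y J in v , dv

  fromDk : Dk n → JK F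
  fromDk (v , dv) = x v , x-irreducible v dv

  x∘toDk : ∀ a → proj₁ a ≡ x (proj₁ (toDk a))
  x∘toDk (y , J) = proj₂ (proj₂ (irreducible⇒x y J))

  toDk∘fromDk : ∀ v → proj₁ (toDk (fromDk v)) ≡ proj₁ v
  toDk∘fromDk (v , dv) = x-injective _ v (proj₂ (toDk (fromDk (v , dv)))) dv
    (sym (x∘toDk (fromDk (v , dv))))

  involution : JK F → JK F
  involution a = let (v , dv) = toDk a in fromDk (invⁿ v , Dk-invⁿ v dv)

  isInvolution : IsJKInvolution F involution
  isInvolution a = let (v , dv) = toDk a in
    subst (λ y → IsMeet F (Excl F y) (x (invⁿ v))) (sym (x∘toDk a)) (x-involution v dv)

  order : ∀ a b → proj₁ a ≤ proj₁ b ⇔ T (proj₁ (toDk a) ≤ⁿ proj₁ (toDk b))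
  order a b = mk⇔
    (λ le → x-reflects v w dv (subst₂ _≤_ (x∘toDk a) (x∘toDk b) le))
    (λ le → subst₂ _≤_ (sym (x∘toDk a)) (sym (x∘toDk b)) (mono-mono g v w le))
    where
      v = proj₁ (toDk a)
      w = proj₁ (toDk b)
      dv = proj₂ (toDk a)

  iso : JKIso F involution n
  iso = record
    { to = toDk ; from = fromDk
    ; from∘to = λ a → sym (x∘toDk a)
    ; to∘from = toDk∘fromDk
    ; order = order
    ; involution = λ a → toDk∘fromDk _ }

proposition7 : (n : ℕ) (F : KleeneAlgebra) (g : Fin n → KleeneAlgebra.Carrier F) →
    IsFreeKleene n F g →
    Σ (JK F → JK F) λ i → IsJKInvolution F i × JKIso F i n
proposition7 n F g free = involution , isInvolution , iso
  where open FreeKleene n F g free
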